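{- Let $G,H$ be strongly connected graphs with $H\leq_R G$ and let $\Phi\in\hom_R(G,H)$. Let $I,J\in V(H)$ and let $u_1,u_2\in L_{IJ}(H)$ be such that $U_i=(\partial\Phi)^{ -1}(I)\cdot u_i$ ($i=1,2$) are minimal images. If $|U_1\,\Delta\,U_2|=2$, say $U_1\,\Delta\,U_2=\{J_1,J_2\}$, where $\Delta$ denotes symmetric difference, then $J_1\sim_\Phi J_2$.
   Context: All graphs are finite directed graphs with state set $V(G)$, edge set $E(G)$, source/target maps $s,t$; loops and parallel edges allowed; all graphs sink-free. $E_I(G)=s^{ -1}(I)$, $L(G)$ finite edge paths, $L_I(G)$ those starting at $I$, $L_{IJ}(G)$ those from $I$ ending at $J$. Strongly connected: a path exists from any state to any state. A homomorphism consists of maps on edges and ($\partial\Phi$) on states commuting with $s,t$. A right-resolver is a surjective homomorphism with $\Phi|_{E_I(G)}:E_I(G)\to E_{\partial\Phi(I)}(H)$ bijective for all $I$; $\hom_R(G,H)$, $H\leq_R G$ if nonempty. For $u\in L_{\partial\Phi(I)}(H)$, $I\cdot u$ is the endpoint of the unique lift of $u$ starting at $I$; $U\cdot u=\{I\cdot u:I\in U\}$. Stability: $I_1\sim_\Phi I_2$ iff $\partial\Phi(I_1)=\partial\Phi(I_2)=:I$ and for every $u\in L_I(H)$ there is $v\in L_{t(u)}(H)$ with $I_1\cdot uv=I_2\cdot uv$. A minimal image is a set $U=(\partial\Phi)^{ -1}(I)\cdot u$ with $u\in L_I(H)$ such that $|U\cdot v|=|U|$ for every $v\in L_{t(u)}(H)$.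 -}

module Defs where

open import Data.Nat using (ℕ; zero; suc)
open import Data.Fin using (Fin; zero; suc; _≟_)
open import Data.Fin.Subset using (Subset; ∣_∣; _∪_; _─_)
open import Data.Bool using (Bool; true; false; _∨_; _∧_)
open import Data.Maybe using (Maybe; just; nothing)
open import Data.Vec using (tabulate)
open import Data.Product using (Σ; ∃; ∃-syntax; _×_; _,_; proj₁; proj₂)
open import Function using (_∘_)
open import Relation.Nullary using (does; yes; no)
open import Relation.Binary.PropositionalEquality using (_≡_; refl; sym; trans; cong)

record Graph : Set where
  field
    nV nE : ℕ
    src tgt : Fin nE → Fin nV
    sinkFree : ∀ (I : Fin nV) → ∃[ e ] src e ≡ I

open Graph public

V : Graph → Set
V G = Fin (nV G)

E : Graph → Set
E G = Fin (nE G)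

data Path (G : Graph) : V G → V G → Set where
  []  : ∀ {I} → Path G I I
  cons : ∀ {I J} (e : E G) → src G e ≡ I → Path G (tgt G e) J → Path G I J

_++_ : ∀ {G I J K} → Path G I J → Path G J K → Path G I K
[] ++ v = v
cons e p u ++ v = cons e p (u ++ v)

StronglyConnected : Graph → Set
StronglyConnected G = ∀ (I J : V G) → Path G I J

record Hom (G H : Graph) : Set where
  field
    Φ : E G → E H
    ∂Φ : V G → V H
    src-comm : ∀ e → src H (Φ e) ≡ ∂Φ (src G e)
    tgt-comm : ∀ e → tgt H (Φ e) ≡ ∂Φ (tgt G e)

open Hom public

record RightResolver (G H : Graph) : Set where
  field
    hom : Hom G H
    surjE : ∀ (f : E H) → ∃[ e ] Φ hom e ≡ f
    surjV : ∀ (K : V H) → ∃[ I ] ∂Φ hom I ≡ K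
    resolve : ∀ (I : V G) (f : E H) → src H f ≡ ∂Φ hom I →
              Σ (E G) λ e → src G e ≡ I × Φ hom e ≡ f
    resolve-inj : ∀ (I : V G) (e₁ e₂ : E G) → src G e₁ ≡ I → src G e₂ ≡ I →
                  Φ hom e₁ ≡ Φ hom e₂ → e₁ ≡ e₂

open RightResolver public

_≤R_ : Graph → Graph → Set
H ≤R G = RightResolver G H

module _ {G H : Graph} (R : RightResolver G H) where

  private
    ∂ = ∂Φ (hom R)

  -- I · u : endpoint of the unique lift starting at I of a path u starting at ∂Φ(I)
  -- (given as a path starting at K together with a proof ∂Φ(I) ≡ K).
  dot : ∀ (I : V G) {K J} → ∂ I ≡ K → Path H K J → V G
  dot I eq [] = I
  dot I eq (cons f p q) =
    let r = resolve R I f (trans p (sym eq))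
        e = proj₁ r
    in dot (tgt G e) (trans (sym (tgt-comm (hom R) e)) (cong (tgt H) (proj₂ (proj₂ r)))) q

  _·_ : ∀ (I : V G) {J} → Path H (∂ I) J → V G
  I · u = dot I refl u

  move : ∀ (I' : V G) {K J} → Path H K J → Maybe (V G)
  move I' {K} u with ∂ I' ≟ K
  ... | yes eq = just (dot I' eq u)
  ... | no _ = nothing

  anyᵇ : ∀ {n} → (Fin n → Bool) → Bool
  anyᵇ {zero} f = false
  anyᵇ {suc n} f = f zero ∨ anyᵇ (f ∘ suc)

  sameAs : Maybe (V G) → V G → Bool
  sameAs (just x) y = does (x ≟ y)
  sameAs nothing y = false

  fiber : V H → Subset (nV G)
  fiber K = tabulate λ I' → does (∂ I' ≟ K)

  -- W · u = { I' · u : I' ∈ W }  (for W ⊆ (∂Φ)⁻¹(K), u ∈ L_K(H))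
  image : ∀ {K J} → Subset (nV G) → Path H K J → Subset (nV G)
  image W u = tabulate λ L → anyᵇ λ I' → Data.Vec.lookup W I' ∧ sameAs (move I' u) L

  IsMinimalImage : Subset (nV G) → Set
  IsMinimalImage U = Σ (V H) λ K → Σ (V H) λ J → Σ (Path H K J) λ u →
    (U ≡ image (fiber K) u) × (∀ {L} (v : Path H J L) → ∣ image U v ∣ ≡ ∣ U ∣)

  Stable : V G → V G → Set
  Stable J₁ J₂ = Σ (V H) λ K → Σ (∂ J₁ ≡ K) λ e₁ → Σ (∂ J₂ ≡ K) λ e₂ →
    ∀ {L} (u : Path H K L) → Σ (V H) λ M → Σ (Path H L M) λ v →
      dot J₁ e₁ (u ++ v) ≡ dot J₂ e₂ (u ++ v)

_Δ_ : ∀ {n} → Subset n → Subset n → Subset n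
A Δ B = (A ─ B) ∪ (B ─ A)

-- Both minimal images U₁, U₂ live over J and have the same size, since following a path
-- J → I and then uᵢ maps one into the other without collapsing it. With U₁ Δ U₂ = {J₁, J₂}
-- one of them, say J₁, lies in U₁ ∖ U₂ and J₂ in U₂ ∖ U₁. Given any u from J, extend it to
-- w = u y u₁ with y a path back to I. Then U₂·w ⊆ U₁ with |U₂·w| = |U₂| = |U₁|, so
-- U₂·w = U₁ and J₁·w = x·w for some x ∈ U₂. If x ≠ J₂ then x ∈ U₁ ∖ {J₁}, and w would
-- collapse U₁, contradicting minimality; hence J₁·w = J₂·w.
module Submission where

open import Defs
open import Data.Fin.Subset using (∣_∣; _∈_)
open import Relation.Binary.PropositionalEquality using (_≡_; _≢_)

open import Data.Bool using (Bool; true; false; _∧_)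
open import Data.Bool.Properties using (∨-zeroʳ)
open import Data.Empty using (⊥-elim)
open import Data.Fin using (Fin; zero; suc; _≟_)
open import Data.Fin.Properties using (¬Fin0)
open import Data.Fin.Subset using (Subset; Side; inside; outside; _∉_; _⊆_; _∪_; _─_; _-_; ⁅_⁆)
import Data.Fin.Subset as Subset
open import Data.Fin.Subset.Properties
  using (_∈?_; p⊆q⇒∣p∣≤∣q∣; p⊂q⇒∣p∣<∣q∣; ∣p∣≤∣x∷p∣; ∣⊥∣≡0; ∣⁅x⁆∣≡1; x∈⁅x⁆; ∪-comm; x∈p∪q⁻; x∈p∪q⁺;
         x∈p∧x∉q⇒x∈p─q; p─q⊆p; x∈p∧x≢y⇒x∈p-y; x∈p⇒∣p-x∣<∣p∣)
open import Data.Maybe using (Maybe; just; nothing)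
open import Data.Nat using (suc; _+_; _≤_; _<_; z≤n; s≤s)
import Data.Nat.Properties
open Data.Nat.Properties using (≤-refl; ≤-reflexive; ≤-trans; ≤-<-trans; +-suc; +-mono-≤; +-monoʳ-≤; <⇒≱; <-irrefl)
open import Data.Product using (∃; _×_; _,_; proj₁)
open import Data.Sum using (_⊎_; inj₁; inj₂; [_,_]′)
open import Data.Vec using ([]; _∷_; lookup; tabulate; here; there)
open import Data.Vec.Properties using (lookup∘tabulate; []=⇒lookup; lookup⇒[]=)
open import Function using (_∘_; id)
open import Relation.Binary.PropositionalEquality using (refl; sym; trans; cong; subst)
open import Relation.Nullary using (¬_; yes; no; does)
open import Relation.Nullary.Decidable using (decidable-stable)

x∈p─q⇒x∉q : ∀ {n} (p q : Subset n) {x} → x ∈ p ─ q → x ∉ q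
x∈p─q⇒x∉q (_ ∷ p) (outside ∷ q) here      ()
x∈p─q⇒x∉q (_ ∷ p) (_ ∷ q)       (there x∈) (there x∈q) = x∈p─q⇒x∉q p q x∈ x∈q

∣p∪q∣≤∣p∣+∣q∣ : ∀ {n} (p q : Subset n) → ∣ p ∪ q ∣ ≤ ∣ p ∣ + ∣ q ∣
∣p∪q∣≤∣p∣+∣q∣ []            []            = z≤n
∣p∪q∣≤∣p∣+∣q∣ (outside ∷ p) (outside ∷ q) = ∣p∪q∣≤∣p∣+∣q∣ p q
∣p∪q∣≤∣p∣+∣q∣ (outside ∷ p) (inside ∷ q)  rewrite +-suc ∣ p ∣ ∣ q ∣ = s≤s (∣p∪q∣≤∣p∣+∣q∣ p q)
∣p∪q∣≤∣p∣+∣q∣ (inside ∷ p)  (s ∷ q)       =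
  s≤s (≤-trans (∣p∪q∣≤∣p∣+∣q∣ p q) (+-monoʳ-≤ ∣ p ∣ (∣p∣≤∣x∷p∣ s q)))

p⊆q∧∣q∣≤∣p∣⇒q⊆p : ∀ {n} {p q : Subset n} → p ⊆ q → ∣ q ∣ ≤ ∣ p ∣ → q ⊆ p
p⊆q∧∣q∣≤∣p∣⇒q⊆p {p = p} p⊆q ∣q∣≤∣p∣ {x} x∈q with x ∈? p
... | yes x∈p = x∈p
... | no  x∉p = ⊥-elim (<⇒≱ (p⊂q⇒∣p∣<∣q∣ (p⊆q , x , x∈q , x∉p)) ∣q∣≤∣p∣)

∣p∣≡2⇒x≡a⊎x≡b : ∀ {n} {p : Subset n} {a b x} → ∣ p ∣ ≡ 2 → a ≢ b →
                a ∈ p → b ∈ p → x ∈ p → x ≡ a ⊎ x ≡ b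
∣p∣≡2⇒x≡a⊎x≡b {p = p} {a} {b} {x} ∣p∣≡2 a≢b a∈p b∈p x∈p with x ≟ a | x ≟ b
... | yes x≡a | _       = inj₁ x≡a
... | no  _   | yes x≡b = inj₂ x≡b
... | no  x≢a | no  x≢b = ⊥-elim (<-irrefl (sym ∣p∣≡2) three≤∣p∣)
  where
  b∈p-a : b ∈ p - a
  b∈p-a = x∈p∧x≢y⇒x∈p-y b∈p (a≢b ∘ sym)
  x∈p-a-b : x ∈ p - a - b
  x∈p-a-b = x∈p∧x≢y⇒x∈p-y (x∈p∧x≢y⇒x∈p-y x∈p x≢a) x≢b
  three≤∣p∣ : 3 ≤ ∣ p ∣
  three≤∣p∣ = ≤-trans (s≤s (≤-trans (s≤s (≤-trans (s≤s z≤n) (x∈p⇒∣p-x∣<∣p∣ x∈p-a-b)))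
                                     (x∈p⇒∣p-x∣<∣p∣ b∈p-a)))
                      (x∈p⇒∣p-x∣<∣p∣ a∈p)

∈Δ⁻ : ∀ {n} {p q : Subset n} {x} → x ∈ p Δ q → (x ∈ p × x ∉ q) ⊎ (x ∈ q × x ∉ p)
∈Δ⁻ {p = p} {q} x∈ with x∈p∪q⁻ (p ─ q) (q ─ p) x∈
... | inj₁ x∈p─q = inj₁ (p─q⊆p p q x∈p─q , x∈p─q⇒x∉q p q x∈p─q)
... | inj₂ x∈q─p = inj₂ (p─q⊆p q p x∈q─p , x∈p─q⇒x∉q q p x∈q─p)

∈Δ⁺ : ∀ {n} {p q : Subset n} {x} → (x ∈ p × x ∉ q) ⊎ (x ∈ q × x ∉ p) → x ∈ p Δ q
∈Δ⁺ (inj₁ (x∈p , x∉q)) = x∈p∪q⁺ (inj₁ (x∈p∧x∉q⇒x∈p─q x∈p x∉q))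
∈Δ⁺ (inj₂ (x∈q , x∉p)) = x∈p∪q⁺ (inj₂ (x∈p∧x∉q⇒x∈p─q x∈q x∉p))

Δ-comm : ∀ {n} (p q : Subset n) → p Δ q ≡ q Δ p
Δ-comm p q = ∪-comm (p ─ q) (q ─ p)

module _ {G H : Graph} (R : RightResolver G H) where

  private
    ∂ : V G → V H
    ∂ = ∂Φ (hom R)

  anyᵇ⁻ : ∀ {n} (f : Fin n → Bool) → anyᵇ R f ≡ true → ∃ λ i → f i ≡ true
  anyᵇ⁻ {suc n} f any≡true with f zero in f0
  ... | true  = zero , f0
  ... | false = let i , fi = anyᵇ⁻ (f ∘ suc) any≡true in suc i , fi

  anyᵇ⁺ : ∀ {n} (f : Fin n → Bool) i → f i ≡ true → anyᵇ R f ≡ true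
  anyᵇ⁺ f zero    fi rewrite fi = refl
  anyᵇ⁺ f (suc i) fi rewrite anyᵇ⁺ (f ∘ suc) i fi = ∨-zeroʳ (f zero)

  sameAs⇒≡just : ∀ m L → sameAs R m L ≡ true → m ≡ just L
  sameAs⇒≡just (just x) L same with x ≟ L
  sameAs⇒≡just (just x) L refl | yes refl = refl

  sameAs-refl : ∀ L → sameAs R (just L) L ≡ true
  sameAs-refl L with L ≟ L
  ... | yes _   = refl
  ... | no  L≢L = ⊥-elim (L≢L refl)

  -- image R W u is partialImage W (λ I′ → move R I′ u) by unfolding.
  partialImage : ∀ {n} → Subset n → (Fin n → Maybe (V G)) → Subset (nV G)
  partialImage W g = tabulate λ L → anyᵇ R λ i → lookup W i ∧ sameAs R (g i) L

  ∈-partialImage⁻ : ∀ {n} (W : Subset n) g {L} → L ∈ partialImage W g → ∃ λ i → i ∈ W × g i ≡ just L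
  ∈-partialImage⁻ W g {L} L∈ with anyᵇ⁻ _ (trans (sym (lookup∘tabulate _ L)) ([]=⇒lookup L∈))
  ... | i , Wi∧same with lookup W i in Wi | sameAs R (g i) L in same
  ... | true | true = i , lookup⇒[]= i W Wi , sameAs⇒≡just (g i) L same

  ∈-partialImage⁺ : ∀ {n} (W : Subset n) g {L} i → i ∈ W → g i ≡ just L → L ∈ partialImage W g
  ∈-partialImage⁺ W g {L} i i∈W gi≡L = lookup⇒[]= L (partialImage W g)
    (trans (lookup∘tabulate _ L) (anyᵇ⁺ _ i Wi∧same))
    where
    Wi∧same : lookup W i ∧ sameAs R (g i) L ≡ true
    Wi∧same rewrite []=⇒lookup i∈W | gi≡L = sameAs-refl L

  headImage : Side → Maybe (V G) → Subset (nV G)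
  headImage inside (just L) = ⁅ L ⁆
  headImage _      _        = Subset.⊥

  ∣headImage∣≤ : ∀ s m → ∣ headImage s m ∣ ≤ ∣ s ∷ [] ∣
  ∣headImage∣≤ inside  (just L) = ≤-reflexive (∣⁅x⁆∣≡1 L)
  ∣headImage∣≤ inside  nothing  = ≤-trans (≤-reflexive (∣⊥∣≡0 (nV G))) z≤n
  ∣headImage∣≤ outside m        = ≤-reflexive (∣⊥∣≡0 (nV G))

  partialImage-∷-⊆ : ∀ {n} s (W : Subset n) g →
                     partialImage (s ∷ W) g ⊆ headImage s (g zero) ∪ partialImage W (g ∘ suc)
  partialImage-∷-⊆ s W g L∈ with ∈-partialImage⁻ (s ∷ W) g L∈
  ... | zero  , here      , g0≡L rewrite g0≡L = x∈p∪q⁺ (inj₁ (x∈⁅x⁆ _))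
  ... | suc i , there i∈W , gi≡L = x∈p∪q⁺ (inj₂ (∈-partialImage⁺ W (g ∘ suc) i i∈W gi≡L))

  ∣partialImage∣≤ : ∀ {n} (W : Subset n) g → ∣ partialImage W g ∣ ≤ ∣ W ∣
  ∣partialImage∣≤ [] g = ≤-trans (p⊆q⇒∣p∣≤∣q∣ {q = Subset.⊥} (⊥-elim ∘ ¬Fin0 ∘ proj₁ ∘ ∈-partialImage⁻ [] g))
                                 (≤-reflexive (∣⊥∣≡0 (nV G)))
  ∣partialImage∣≤ (s ∷ W) g = begin
    ∣ partialImage (s ∷ W) g ∣                              ≤⟨ p⊆q⇒∣p∣≤∣q∣ (partialImage-∷-⊆ s W g) ⟩
    ∣ headImage s (g zero) ∪ partialImage W (g ∘ suc) ∣     ≤⟨ ∣p∪q∣≤∣p∣+∣q∣ (headImage s (g zero)) _ ⟩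
    ∣ headImage s (g zero) ∣ + ∣ partialImage W (g ∘ suc) ∣ ≤⟨ +-mono-≤ (∣headImage∣≤ s (g zero)) (∣partialImage∣≤ W (g ∘ suc)) ⟩
    ∣ s ∷ [] ∣ + ∣ W ∣                                      ≡⟨ cons-size s ⟩
    ∣ s ∷ W ∣                                               ∎
    where
    open Data.Nat.Properties.≤-Reasoning
    cons-size : ∀ s → ∣ s ∷ [] ∣ + ∣ W ∣ ≡ ∣ s ∷ W ∣
    cons-size inside  = refl
    cons-size outside = refl

  -- Dropping x from W keeps the image, since y ∈ W still has the same value.
  ∣partialImage∣<-of-collision : ∀ {n} (W : Subset n) g {x y} → x ≢ y → x ∈ W → y ∈ W → g x ≡ g y →
                                 ∣ partialImage W g ∣ < ∣ W ∣
  ∣partialImage∣<-of-collision W g {x} {y} x≢y x∈W y∈W gx≡gy =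
    ≤-<-trans (p⊆q⇒∣p∣≤∣q∣ ⊆-without-x) (≤-<-trans (∣partialImage∣≤ (W - x) g) (x∈p⇒∣p-x∣<∣p∣ x∈W))
    where
    ⊆-without-x : partialImage W g ⊆ partialImage (W - x) g
    ⊆-without-x L∈ with ∈-partialImage⁻ W g L∈
    ... | i , i∈W , gi≡L with i ≟ x
    ... | yes refl = ∈-partialImage⁺ (W - x) g y (x∈p∧x≢y⇒x∈p-y y∈W (x≢y ∘ sym)) (trans (sym gx≡gy) gi≡L)
    ... | no  i≢x  = ∈-partialImage⁺ (W - x) g i (x∈p∧x≢y⇒x∈p-y i∈W i≢x) gi≡L

  dot-cong : ∀ {I I′ K J} → I ≡ I′ → (e : ∂ I ≡ K) (e′ : ∂ I′ ≡ K) (u : Path H K J) →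
             dot R I e u ≡ dot R I′ e′ u
  dot-cong refl refl refl u = refl

  ∂-dot : ∀ I {K J} (e : ∂ I ≡ K) (u : Path H K J) → ∂ (dot R I e u) ≡ J
  ∂-dot I e []           = e
  ∂-dot I e (cons f _ u) = ∂-dot _ _ u

  dot-++ : ∀ I {K J M} (e : ∂ I ≡ K) (u : Path H K J) (v : Path H J M) →
           dot R I e (u ++ v) ≡ dot R (dot R I e u) (∂-dot I e u) v
  dot-++ I e []           v = refl
  dot-++ I e (cons f _ u) v = dot-++ _ _ u v

  ++-assoc : ∀ {K L M N} (u : Path H K L) (v : Path H L M) (w : Path H M N) →
             (u ++ v) ++ w ≡ u ++ (v ++ w)
  ++-assoc []           v w = refl
  ++-assoc (cons f p u) v w = cong (cons f p) (++-assoc u v w)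

  move≡just-dot : ∀ I {K J} (u : Path H K J) (e : ∂ I ≡ K) → move R I u ≡ just (dot R I e u)
  move≡just-dot I {K} u e with ∂ I ≟ K
  ... | yes e′  = cong just (dot-cong refl e′ e u)
  ... | no  ∂≢K = ⊥-elim (∂≢K e)

  move≡just⁻ : ∀ I {K J} (u : Path H K J) {L} → move R I u ≡ just L → ∃ λ (e : ∂ I ≡ K) → dot R I e u ≡ L
  move≡just⁻ I {K} u moved with ∂ I ≟ K
  move≡just⁻ I {K} u refl | yes e = e , refl

  ∈-image⁻ : ∀ (W : Subset (nV G)) {K J} (u : Path H K J) {L} → L ∈ image R W u →
             ∃ λ I → I ∈ W × ∃ λ (e : ∂ I ≡ K) → dot R I e u ≡ L
  ∈-image⁻ W u L∈ with ∈-partialImage⁻ W (λ I → move R I u) L∈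
  ... | I , I∈W , moved = I , I∈W , move≡just⁻ I u moved

  ∈-image⁺ : ∀ (W : Subset (nV G)) {K J} (u : Path H K J) {I} → I ∈ W → (e : ∂ I ≡ K) →
             dot R I e u ∈ image R W u
  ∈-image⁺ W u {I} I∈W e = ∈-partialImage⁺ W (λ I → move R I u) I I∈W (move≡just-dot I u e)

  ∈-fiber⁺ : ∀ K {I} → ∂ I ≡ K → I ∈ fiber R K
  ∈-fiber⁺ K {I} e = lookup⇒[]= I (fiber R K) (trans (lookup∘tabulate (λ I′ → does (∂ I′ ≟ K)) I) decided)
    where
    decided : does (∂ I ≟ K) ≡ true
    decided with ∂ I ≟ K
    ... | yes _   = refl
    ... | no  ∂≢K = ⊥-elim (∂≢K e)

  ∂-∈-image-fiber : ∀ {K J} (u : Path H K J) {L} → L ∈ image R (fiber R K) u → ∂ L ≡ J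
  ∂-∈-image-fiber {K} u L∈ with ∈-image⁻ (fiber R K) u L∈
  ... | I , _ , e , refl = ∂-dot I e u

  dot-++-∈-image-fiber : ∀ {I J} (u : Path H I J) L {K} (e : ∂ L ≡ K) (p : Path H K I) →
                         dot R L e (p ++ u) ∈ image R (fiber R I) u
  dot-++-∈-image-fiber {I} u L e p = subst (_∈ image R (fiber R I) u) (sym (dot-++ L e p u))
    (∈-image⁺ (fiber R I) u (∈-fiber⁺ I (∂-dot L e p)) (∂-dot L e p))

  image-++-⊆-image-fiber : ∀ (W : Subset (nV G)) {K I J} (p : Path H K I) (u : Path H I J) →
                           image R W (p ++ u) ⊆ image R (fiber R I) u
  image-++-⊆-image-fiber W p u L∈ with ∈-image⁻ W (p ++ u) L∈
  ... | L , _ , e , refl = dot-++-∈-image-fiber u L e p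

  MinimalAt : V H → Subset (nV G) → Set
  MinimalAt J U = ∀ {L} (v : Path H J L) → ∣ image R U v ∣ ≡ ∣ U ∣

  image-fiber-nonempty : ∀ {I J} (u : Path H I J) → ∃ λ L → L ∈ image R (fiber R I) u
  image-fiber-nonempty {I} u with surjV R I
  ... | I₀ , I₀↦I = dot R I₀ I₀↦I u , ∈-image⁺ (fiber R I) u (∈-fiber⁺ I I₀↦I) I₀↦I

  IsMinimalImage⇒MinimalAt : ∀ {I J} (u : Path H I J) →
    IsMinimalImage R (image R (fiber R I) u) → MinimalAt J (image R (fiber R I) u)
  IsMinimalImage⇒MinimalAt {I} {J} u (_ , J′ , u′ , U≡ , minimal) =
    subst (λ M → MinimalAt M (image R (fiber R I) u)) J′≡J minimal
    where
    J′≡J : J′ ≡ J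
    J′≡J with image-fiber-nonempty u
    ... | L , L∈U = trans (sym (∂-∈-image-fiber u′ (subst (L ∈_) U≡ L∈U))) (∂-∈-image-fiber u L∈U)

  MinimalAt⇒dot-injective : ∀ {J U} → MinimalAt J U → ∀ {L} (v : Path H J L) {x y}
    (ex : ∂ x ≡ J) (ey : ∂ y ≡ J) → x ∈ U → y ∈ U → dot R x ex v ≡ dot R y ey v → x ≡ y
  MinimalAt⇒dot-injective {U = U} minimal v {x} {y} ex ey x∈U y∈U x·v≡y·v with x ≟ y
  ... | yes x≡y = x≡y
  ... | no  x≢y = ⊥-elim (<-irrefl (minimal v)
    (∣partialImage∣<-of-collision U (λ I → move R I v) x≢y x∈U y∈U
      (trans (move≡just-dot x v ex) (trans (cong just x·v≡y·v) (sym (move≡just-dot y v ey))))))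

  module _ (strong : StronglyConnected H) {I J : V H} where

    private
      Im : Path H I J → Subset (nV G)
      Im u = image R (fiber R I) u

    -- Going back to I and then along ua maps Im ub into Im ua without shrinking it.
    ∣minimal-image∣≤ : (ua ub : Path H I J) → MinimalAt J (Im ub) → ∣ Im ub ∣ ≤ ∣ Im ua ∣
    ∣minimal-image∣≤ ua ub minimal = begin
      ∣ Im ub ∣                              ≡⟨ minimal (strong J I ++ ua) ⟨
      ∣ image R (Im ub) (strong J I ++ ua) ∣ ≤⟨ p⊆q⇒∣p∣≤∣q∣ (image-++-⊆-image-fiber (Im ub) (strong J I) ua) ⟩
      ∣ Im ua ∣                              ∎
      where open Data.Nat.Properties.≤-Reasoning

    stable-of-exchange : (ua ub : Path H I J) → MinimalAt J (Im ua) → MinimalAt J (Im ub) →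
      ∀ {J₁ J₂} → J₁ ∈ Im ua → J₁ ∉ Im ub → J₂ ∈ Im ub →
      (∀ {x} → x ∈ Im ub → x ∉ Im ua → x ≡ J₂) → Stable R J₁ J₂
    stable-of-exchange ua ub minimal-a minimal-b {J₁} {J₂} J₁∈a J₁∉b J₂∈b b∖a⊆J₂ =
      J , e₁ , e₂ , λ {L} u → J , strong L I ++ ua ,
        subst (λ w → dot R J₁ e₁ w ≡ dot R J₂ e₂ w) (++-assoc u (strong L I) ua) (meet (u ++ strong L I))
      where
      e₁ : ∂ J₁ ≡ J
      e₁ = ∂-∈-image-fiber ua J₁∈a
      e₂ : ∂ J₂ ≡ J
      e₂ = ∂-∈-image-fiber ub J₂∈b

      -- b·w ⊆ a with |a| ≤ |b| = |b·w| forces b·w = a.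
      J₁·w∈b·w : (p : Path H J I) → dot R J₁ e₁ (p ++ ua) ∈ image R (Im ub) (p ++ ua)
      J₁·w∈b·w p = p⊆q∧∣q∣≤∣p∣⇒q⊆p (image-++-⊆-image-fiber (Im ub) p ua)
        (≤-trans (∣minimal-image∣≤ ub ua minimal-a) (≤-reflexive (sym (minimal-b (p ++ ua)))))
        (dot-++-∈-image-fiber ua J₁ e₁ p)

      only-J₂-meets-J₁ : (p : Path H J I) → ∀ {x} → x ∈ Im ub → (ex : ∂ x ≡ J) →
                         dot R x ex (p ++ ua) ≡ dot R J₁ e₁ (p ++ ua) → x ≡ J₂
      only-J₂-meets-J₁ p {x} x∈b ex x·w≡J₁·w with x ∈? Im ua
      ... | no  x∉a = b∖a⊆J₂ x∈b x∉a
      ... | yes x∈a = ⊥-elim (J₁∉b (subst (_∈ Im ub)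
            (MinimalAt⇒dot-injective minimal-a (p ++ ua) ex e₁ x∈a J₁∈a x·w≡J₁·w) x∈b))

      meet : (p : Path H J I) → dot R J₁ e₁ (p ++ ua) ≡ dot R J₂ e₂ (p ++ ua)
      meet p =
        let x , x∈b , ex , x·w≡J₁·w = ∈-image⁻ (Im ub) (p ++ ua) (J₁·w∈b·w p)
        in trans (sym x·w≡J₁·w) (dot-cong (only-J₂-meets-J₁ p x∈b ex x·w≡J₁·w) ex e₂ (p ++ ua))

    stable-of-Δ-pair : (ua ub : Path H I J) → MinimalAt J (Im ua) → MinimalAt J (Im ub) →
      ∀ {J₁ J₂} → ∣ Im ua Δ Im ub ∣ ≡ 2 → J₁ ≢ J₂ → J₂ ∈ Im ua Δ Im ub →
      J₁ ∈ Im ua × J₁ ∉ Im ub → Stable R J₁ J₂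
    stable-of-Δ-pair ua ub minimal-a minimal-b {J₁} {J₂} ∣Δ∣≡2 J₁≢J₂ J₂∈Δ (J₁∈a , J₁∉b) =
      stable-of-exchange ua ub minimal-a minimal-b J₁∈a J₁∉b J₂∈b b∖a⊆J₂
      where
      b∖a⊆J₂ : ∀ {x} → x ∈ Im ub → x ∉ Im ua → x ≡ J₂
      b∖a⊆J₂ x∈b x∉a =
        [ (λ x≡J₁ → ⊥-elim (x∉a (subst (_∈ Im ua) (sym x≡J₁) J₁∈a))) , id ]′
        (∣p∣≡2⇒x≡a⊎x≡b ∣Δ∣≡2 J₁≢J₂ (∈Δ⁺ (inj₁ (J₁∈a , J₁∉b))) J₂∈Δ (∈Δ⁺ (inj₂ (x∈b , x∉a))))

      -- If J₂ were in a as well, b ⊆ a, and equal sizes would put J₁ ∈ b.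
      J₂∉a∖b : ¬ (J₂ ∈ Im ua × J₂ ∉ Im ub)
      J₂∉a∖b (J₂∈a , _) = J₁∉b (p⊆q∧∣q∣≤∣p∣⇒q⊆p b⊆a (∣minimal-image∣≤ ub ua minimal-a) J₁∈a)
        where
        b⊆a : Im ub ⊆ Im ua
        b⊆a {x} x∈b = decidable-stable (x ∈? Im ua)
          (λ x∉a → x∉a (subst (_∈ Im ua) (sym (b∖a⊆J₂ x∈b x∉a)) J₂∈a))

      J₂∈b : J₂ ∈ Im ub
      J₂∈b = [ ⊥-elim ∘ J₂∉a∖b , proj₁ ]′ (∈Δ⁻ J₂∈Δ)

proposition3p18 : (G H : Graph) → StronglyConnected G → StronglyConnected H →
    H ≤R G → (R : RightResolver G H) →
    (I J : V H) (u₁ u₂ : Path H I J) →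
    IsMinimalImage R (image R (fiber R I) u₁) →
    IsMinimalImage R (image R (fiber R I) u₂) →
    ∣ image R (fiber R I) u₁ Δ image R (fiber R I) u₂ ∣ ≡ 2 →
    (J₁ J₂ : V G) → J₁ ≢ J₂ →
    J₁ ∈ (image R (fiber R I) u₁ Δ image R (fiber R I) u₂) →
    J₂ ∈ (image R (fiber R I) u₁ Δ image R (fiber R I) u₂) →
    Stable R J₁ J₂
proposition3p18 G H _ strong _ R I J u₁ u₂ min₁ min₂ ∣Δ∣≡2 J₁ J₂ J₁≢J₂ J₁∈Δ J₂∈Δ =
  [ stable-of-Δ-pair R strong u₁ u₂ minimal₁ minimal₂ ∣Δ∣≡2 J₁≢J₂ J₂∈Δ
  , stable-of-Δ-pair R strong u₂ u₁ minimal₂ minimal₁ (subst (λ S → ∣ S ∣ ≡ 2) Δ-swap ∣Δ∣≡2) J₁≢J₂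
      (subst (J₂ ∈_) Δ-swap J₂∈Δ)
  ]′ (∈Δ⁻ J₁∈Δ)
  where
  U₁ U₂ : Subset (nV G)
  U₁ = image R (fiber R I) u₁
  U₂ = image R (fiber R I) u₂
  minimal₁ : MinimalAt R J U₁
  minimal₁ = IsMinimalImage⇒MinimalAt R u₁ min₁
  minimal₂ : MinimalAt R J U₂
  minimal₂ = IsMinimalImage⇒MinimalAt R u₂ min₂
  Δ-swap : U₁ Δ U₂ ≡ U₂ Δ U₁
  Δ-swap = Δ-comm U₁ U₂
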